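{- Let $G=(V,E)$ be a hypergraph and let $OPT_k$ be the value of a minimum $k$-cut-set in $G$ for some integer $k\ge 2$. Suppose $(U,\overline{U})$ is a $2$-partition of $V$ with $d(U)<OPT_k$. Then, for every vertex $t\in\overline{U}$, there exists a subset $T\subseteq\overline{U}\setminus\{t\}$ with $|T|\le 2k-3$ such that $(U,\overline{U})$ is the unique minimum $(U,T\cup\{t\})$-terminal cut.
   Context: A hypergraph $G=(V,E)$ consists of a finite vertex set $V$ and a finite multiset $E$ of hyperedges, each a subset of $V$ (unit costs). For $U\subseteq V$, $\overline{U}:=V\setminus U$ and $d(U)$ is the number of hyperedges intersecting both $U$ and $\overline{U}$. A subset $F\subseteq E$ is a $k$-cut-set if $(V,E\setminus F)$ has at least $k$ connected components; $OPT_k$ is the minimum of $|F|$ over all $k$-cut-sets. For disjoint non-empty $X,Y\subseteq V$, a $2$-partition $(A,\overline{A})$ is an $(X,Y)$-terminal cut if $X\subseteq A\subseteq V\setminus Y$; a minimum $(X,Y)$-terminal cut minimizes $d(A)$ among such cuts. -}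

module Defs where

open import Data.Nat using (ℕ; zero; suc; _+_)
open import Data.Bool using (Bool; true; false; _∧_; _∨_; if_then_else_)
open import Data.Fin using (Fin)
open import Data.Fin.Subset using (Subset; _∈_; _∉_; ∁; ∣_∣)
open import Data.Vec using (Vec; []; _∷_; lookup)
open import Data.Product using (Σ; ∃; _×_)
open import Relation.Binary.PropositionalEquality using (_≡_; _≢_)
open import Relation.Binary.Construct.Closure.ReflexiveTransitive using (Star)
open import Relation.Nullary using (¬_)

-- A hypergraph on vertex set Fin n with m hyperedges (a multiset of
-- hyperedges, given as an m-indexed vector of subsets of the vertices).
record Hypergraph : Set where
  field
    n : ℕ
    m : ℕ
    edges : Vec (Subset n) m
open Hypergraph public

meets : ∀ {n} → Subset n → Subset n → Bool
meets [] [] = false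
meets (x ∷ xs) (y ∷ ys) = (x ∧ y) ∨ meets xs ys

crosses : ∀ {n} → Subset n → Subset n → Bool
crosses e U = meets e U ∧ meets e (∁ U)

countCrossing : ∀ {n m} → Vec (Subset n) m → Subset n → ℕ
countCrossing [] U = 0
countCrossing (e ∷ es) U = (if crosses e U then 1 else 0) + countCrossing es U

d : (G : Hypergraph) → Subset (n G) → ℕ
d G U = countCrossing (edges G) U

-- A subset F of the hyperedges (by index); u, v adjacent in (V, E \ F)
-- if some hyperedge not in F contains both.
Adjacent : (G : Hypergraph) → Subset (m G) → Fin (n G) → Fin (n G) → Set
Adjacent G F u v = ∃ λ i → (i ∉ F) × (u ∈ lookup (edges G) i) × (v ∈ lookup (edges G) i)

Connected : (G : Hypergraph) → Subset (m G) → Fin (n G) → Fin (n G) → Set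
Connected G F = Star (Adjacent G F)

-- (V, E \ F) has at least k connected components: there are k vertices
-- lying in pairwise distinct components.
AtLeastComponents : (G : Hypergraph) → Subset (m G) → ℕ → Set
AtLeastComponents G F k =
  Σ (Fin k → Fin (n G)) λ f → ∀ i j → i ≢ j → ¬ Connected G F (f i) (f j)

IsKCutSet : (G : Hypergraph) → ℕ → Subset (m G) → Set
IsKCutSet G k F = AtLeastComponents G F k

IsMinKCutSet : (G : Hypergraph) → ℕ → Subset (m G) → Set
IsMinKCutSet G k F = IsKCutSet G k F × (∀ F′ → IsKCutSet G k F′ → ∣ F ∣ Data.Nat.≤ ∣ F′ ∣)
  where import Data.Nat

IsTerminalCut : (G : Hypergraph) → Subset (n G) → Subset (n G) → Subset (n G) → Set
IsTerminalCut G X Y A = (X Data.Fin.Subset.⊆ A) × (A Data.Fin.Subset.⊆ ∁ Y)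
  where import Data.Fin.Subset

IsUniqueMinTerminalCut : (G : Hypergraph) → Subset (n G) → Subset (n G) → Subset (n G) → Set
IsUniqueMinTerminalCut G X Y A =
  IsTerminalCut G X Y A ×
  (∀ B → IsTerminalCut G X Y B → d G A Data.Nat.≤ d G B) ×
  (∀ B → IsTerminalCut G X Y B → d G B ≡ d G A → B ≡ A)
  where import Data.Nat

{-# OPTIONS --safe #-}
-- Call Z a rival if Z is a nonempty set of vertices outside U ∪ {t} with d(U ∪ Z) ≤ d(U), and
-- say that T pins U if every rival meets T. If T ⊆ ∁U pins U, then U is the unique minimum
-- (U, T ∪ {t})-terminal cut, since any other such cut B gives the rival B ∖ U, which avoids T.
-- The set ∁U − t pins U, so it contains an irreducible pinning set T, and it remains to bound ∣T∣.
-- If T had N = 2(k − 1) elements x_l, irreducibility would give rivals Z_l with Z_l ∩ T = {x_l}.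
-- Put A_l = U ∪ Z_l, let h(v) count the A_l containing v, and let the labelling ℓ₁ (resp. ℓ₂)
-- give a vertex lying in exactly one A_l the position, counted from 1, of l within the first
-- (resp. second) half of the indices, and 0 otherwise. Counting crossings edge by edge gives
--   cost ℓ₁ + cost ℓ₂ + Σ_{r=3}^{N} d({h ≥ r}) ≤ Σ_l d(A_l) ≤ N·d(U),
-- where cost ℓ is the number of edges on which ℓ is not constant. Each level set {h ≥ r} with
-- r ≥ 2 is U together with a set avoiding T ∪ {t}, so d(U) ≤ d({h ≥ r}), and therefore some
-- cost ℓᵢ ≤ d(U) < OPT_k. But deleting the edges on which ℓᵢ is not constant separates a vertex
-- of U from the k − 1 vertices x_l of that half: a k-cut-set cheaper than OPT_k.

module Submission where

open import Data.Bool using (Bool; true; false; T; if_then_else_)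
open import Data.Bool.Properties using (T-∧)
open import Data.Fin using (Fin; zero; suc; toℕ; splitAt; _↑ˡ_; _↑ʳ_; inject≤)
open import Data.Fin.Properties
  using (any?; all?; toℕ<n; toℕ-injective; inject≤-injective; splitAt-↑ˡ; splitAt-↑ʳ)
  renaming (_≟_ to _≟ᶠ_; suc-injective to suc-injectiveᶠ)
open import Data.Fin.Subset
  using (Subset; _∈_; _∉_; _⊆_; ∁; _∪_; _∩_; _─_; _-_; ⁅_⁆; ∣_∣; Nonempty; Empty; inside; outside)
open import Data.Fin.Subset.Properties
  using (_∈?_; _⊆?_; nonempty?; anySubset?; x∉p⇒x∈∁p; x∈∁p⇒x∉p; ⊆-antisym; p─q⊆p; x∈p∧x∉q⇒x∈p─q;
         x∈p∪q⁺; x∈p∪q⁻; x∈p∩q⁺; x∈p∩q⁻; x∈p∧x≢y⇒x∈p-y; x∈p⇒∣p-x∣<∣p∣; ∪-identityʳ; Empty-unique;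
         x∈⁅x⁆; x∈⁅y⁆⇒x≡y)
open import Data.Nat using (ℕ; zero; suc; _+_; _*_; _∸_; _⊔_; _≤_; _<_; z≤n; s≤s; s≤s⁻¹; _≤?_; _<?_)
open import Data.Nat.Induction using (<-wellFounded)
open import Data.Nat.Properties
open import Algebra.Properties.CommutativeMonoid.Sum +-0-commutativeMonoid
  using (sum; sum-syntax; ∑-distrib-+; ∑-comm; sum-cong-≗)
open import Data.Product using (∃; _×_; _,_; proj₁; proj₂)
open import Data.Sum as Sum using (_⊎_; inj₁; inj₂)
open import Data.Vec using (Vec; []; _∷_; here; there; lookup; tabulate)
open import Data.Vec.Properties using (lookup∘tabulate; lookup⇒[]=; []=⇒lookup)
open import Function using (id; const; _∘_; flip; Injective; Equivalence)
open import Induction.WellFounded using (Acc; acc)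
open import Relation.Binary using (Transitive; Total)
import Relation.Binary.Construct.Closure.ReflexiveTransitive as Star
open import Relation.Binary.PropositionalEquality
open import Relation.Nullary using (¬_; ¬?; Dec; yes; no; does; _×-dec_; _→-dec_; contradiction)
open import Relation.Nullary.Decidable using (dec-true; dec-false; map′; T?; decidable-stable)
open import Relation.Unary using (Decidable)

open import Defs

ind : Bool → ℕ
ind b = if b then 1 else 0

⟦_⟧ : ∀ {P : Set} → Dec P → ℕ
⟦ P? ⟧ = ind (does P?)

module _ {P : Set} (P? : Dec P) where

  ⟦⟧-yes : P → ⟦ P? ⟧ ≡ 1
  ⟦⟧-yes p = cong ind (dec-true P? p)

  ⟦⟧-no : ¬ P → ⟦ P? ⟧ ≡ 0
  ⟦⟧-no ¬p = cong ind (dec-false P? ¬p)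

  ⟦⟧≤1 : ⟦ P? ⟧ ≤ 1
  ⟦⟧≤1 with does P?
  ... | true = ≤-refl
  ... | false = z≤n

⟦⟧-mono : ∀ {P Q : Set} (P? : Dec P) (Q? : Dec Q) → (P → Q) → ⟦ P? ⟧ ≤ ⟦ Q? ⟧
⟦⟧-mono (no _) Q? P⇒Q = z≤n
⟦⟧-mono (yes p) Q? P⇒Q = ≤-reflexive (sym (⟦⟧-yes Q? (P⇒Q p)))

does≡true⇒ : ∀ {P : Set} (P? : Dec P) → does P? ≡ true → P
does≡true⇒ (yes p) _ = p

⟦⟧≢0⇒ : ∀ {P : Set} (P? : Dec P) → ⟦ P? ⟧ ≢ 0 → P
⟦⟧≢0⇒ (yes p) _ = p
⟦⟧≢0⇒ (no _) ≢0 = contradiction refl ≢0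

1+[x∸2]≤ : ∀ x {c} → 1 ≤ c → x ∸ 1 ≤ c → 1 + (x ∸ 2) ≤ c
1+[x∸2]≤ zero 1≤c _ = 1≤c
1+[x∸2]≤ (suc zero) 1≤c _ = 1≤c
1+[x∸2]≤ (suc (suc x)) _ x∸1≤c = x∸1≤c

2+[x∸2]≤ : ∀ x {c} → 2 ≤ c → x ≤ c → 2 + (x ∸ 2) ≤ c
2+[x∸2]≤ zero 2≤c _ = 2≤c
2+[x∸2]≤ (suc zero) 2≤c _ = 2≤c
2+[x∸2]≤ (suc (suc x)) _ x≤c = x≤c

2*[2+K]∸3≡K+[1+K] : ∀ K → 2 * (2 + K) ∸ 3 ≡ K + suc K
2*[2+K]∸3≡K+[1+K] K = trans (cong (_∸ 1) (+-suc K (suc (K + 0)))) (cong (λ x → K + suc x) (+-identityʳ K))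

∑-mono-≤ : ∀ {n} {f g : Fin n → ℕ} → (∀ i → f i ≤ g i) → ∑[ i < n ] f i ≤ ∑[ i < n ] g i
∑-mono-≤ {zero} f≤g = z≤n
∑-mono-≤ {suc n} f≤g = +-mono-≤ (f≤g zero) (∑-mono-≤ (f≤g ∘ suc))

∑-const : ∀ n c → ∑[ i < n ] c ≡ n * c
∑-const zero c = refl
∑-const (suc n) c = cong (c +_) (∑-const n c)

term≤∑ : ∀ {n} (f : Fin n → ℕ) i → f i ≤ ∑[ j < n ] f j
term≤∑ f zero = m≤m+n _ _
term≤∑ f (suc i) = ≤-trans (term≤∑ (f ∘ suc) i) (m≤n+m _ _)

two-terms≤∑ : ∀ {n} (f : Fin n → ℕ) {i j} → i ≢ j → f i + f j ≤ ∑[ l < n ] f l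
two-terms≤∑ f {zero} {zero} i≢j = contradiction refl i≢j
two-terms≤∑ f {zero} {suc j} _ = +-monoʳ-≤ (f zero) (term≤∑ (f ∘ suc) j)
two-terms≤∑ f {suc i} {zero} _ = subst (_≤ sum f) (+-comm (f zero) (f (suc i)))
  (+-monoʳ-≤ (f zero) (term≤∑ (f ∘ suc) i))
two-terms≤∑ f {suc i} {suc j} i≢j =
  ≤-trans (two-terms≤∑ (f ∘ suc) (i≢j ∘ cong suc)) (m≤n+m _ _)

∑-zero : ∀ {n} {f : Fin n → ℕ} → (∀ i → f i ≡ 0) → ∑[ i < n ] f i ≡ 0
∑-zero {n} f≡0 = trans (sum-cong-≗ f≡0) (trans (∑-const n 0) (*-zeroʳ n))

∑-single : ∀ {n} (f : Fin n → ℕ) j → (∀ i → i ≢ j → f i ≡ 0) → ∑[ i < n ] f i ≡ f j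
∑-single f zero others =
  trans (cong (f zero +_) (∑-zero (λ i → others (suc i) λ ()))) (+-identityʳ (f zero))
∑-single f (suc j) others =
  cong₂ _+_ (others zero λ ()) (∑-single (f ∘ suc) j (λ i i≢j → others (suc i) (i≢j ∘ suc-injectiveᶠ)))

∑≢0⇒∃ : ∀ {n} (f : Fin n → ℕ) → ∑[ i < n ] f i ≢ 0 → ∃ λ i → f i ≢ 0
∑≢0⇒∃ {zero} f ∑≢0 = contradiction refl ∑≢0
∑≢0⇒∃ {suc n} f ∑≢0 with f zero ≟ 0
... | no f₀≢0 = zero , f₀≢0
... | yes f₀≡0 with ∑≢0⇒∃ (f ∘ suc) (λ ∑≡0 → ∑≢0 (cong₂ _+_ f₀≡0 ∑≡0))
...   | i , fᵢ≢0 = suc i , fᵢ≢0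

InRange : ℕ → ℕ → ℕ → Set
InRange a b r = a < r × r ≤ b

inRange? : ∀ a b r → Dec (InRange a b r)
inRange? a b r = a <? r ×-dec r ≤? b

∑-inRange≤ : ∀ M a b c → ∑[ i < M ] ⟦ inRange? a b (toℕ i + suc c) ⟧ ≤ b ∸ (a ⊔ c)
∑-inRange≤ zero a b c = z≤n
∑-inRange≤ (suc M) a b c = begin
  ⟦ inRange? a b (suc c) ⟧ + ∑[ i < M ] ⟦ inRange? a b (suc (toℕ i + suc c)) ⟧
    ≡⟨ cong (⟦ inRange? a b (suc c) ⟧ +_)
            (sum-cong-≗ {M} λ i → cong (⟦_⟧ ∘ inRange? a b) (sym (+-suc (toℕ i) (suc c)))) ⟩
  ⟦ inRange? a b (suc c) ⟧ + ∑[ i < M ] ⟦ inRange? a b (toℕ i + suc (suc c)) ⟧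
    ≤⟨ +-monoʳ-≤ _ (∑-inRange≤ M a b (suc c)) ⟩
  ⟦ inRange? a b (suc c) ⟧ + (b ∸ (a ⊔ suc c))
    ≤⟨ leading-term (inRange? a b (suc c)) ⟩
  b ∸ (a ⊔ c) ∎
  where
  open ≤-Reasoning
  leading-term : (r? : Dec (InRange a b (suc c))) → ⟦ r? ⟧ + (b ∸ (a ⊔ suc c)) ≤ b ∸ (a ⊔ c)
  leading-term (yes (s≤s a≤c , c<b)) rewrite m≤n⇒m⊔n≡n a≤c | m≤n⇒m⊔n≡n (m≤n⇒m≤1+n a≤c) =
    ≤-reflexive (sym (+-∸-assoc 1 c<b))
  leading-term (no _) = ∸-monoʳ-≤ b (⊔-monoʳ-≤ a (n≤1+n c))

setOf : ∀ {n} {P : Fin n → Set} → Decidable P → Subset n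
setOf P? = tabulate (does ∘ P?)

module _ {n} {P : Fin n → Set} (P? : Decidable P) where

  ∈-setOf⁺ : ∀ {x} → P x → x ∈ setOf P?
  ∈-setOf⁺ {x} px = lookup⇒[]= x (setOf P?) (trans (lookup∘tabulate (does ∘ P?) x) (dec-true (P? x) px))

  ∈-setOf⁻ : ∀ {x} → x ∈ setOf P? → P x
  ∈-setOf⁻ {x} x∈ = does≡true⇒ (P? x) (trans (sym (lookup∘tabulate (does ∘ P?) x)) ([]=⇒lookup x∈))

∣setOf∣ : ∀ {n} {P : Fin n → Set} (P? : Decidable P) → ∣ setOf P? ∣ ≡ ∑[ i < n ] ⟦ P? i ⟧
∣setOf∣ {zero} P? = refl
∣setOf∣ {suc n} P? with does (P? zero)
... | true = cong suc (∣setOf∣ (P? ∘ suc))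
... | false = ∣setOf∣ (P? ∘ suc)

x∈p─q⇒x∉q : ∀ {n} {p q : Subset n} {x} → x ∈ p ─ q → x ∉ q
x∈p─q⇒x∉q {p = _ ∷ _} {outside ∷ _} here ()
x∈p─q⇒x∉q {p = _ ∷ _} {_ ∷ _} (there x∈p─q) (there x∈q) = x∈p─q⇒x∉q x∈p─q x∈q

p⊆q⇒p∪[q─p]≡q : ∀ {n} {p q : Subset n} → p ⊆ q → p ∪ (q ─ p) ≡ q
p⊆q⇒p∪[q─p]≡q {p = p} {q} p⊆q = ⊆-antisym (Sum.[ p⊆q , p─q⊆p q p ] ∘ x∈p∪q⁻ p (q ─ p)) q⊆
  where
  q⊆ : q ⊆ p ∪ (q ─ p)
  q⊆ {x} x∈q with x ∈? p
  ... | yes x∈p = x∈p∪q⁺ (inj₁ x∈p)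
  ... | no x∉p = x∈p∪q⁺ (inj₂ (x∈p∧x∉q⇒x∈p─q x∈q x∉p))

module _ {_≼_ : ℕ → ℕ → Set} (≼-trans : Transitive _≼_) (≼-total : Total _≼_) where

  private
    ≼-refl : ∀ {a} → a ≼ a
    ≼-refl {a} with ≼-total a a
    ... | inj₁ a≼a = a≼a
    ... | inj₂ a≼a = a≼a

  extremum : ∀ {n} (f : Fin n → ℕ) (p : Subset n) → Nonempty p →
             ∃ λ x → x ∈ p × (∀ {y} → y ∈ p → f x ≼ f y)
  extremum f (outside ∷ p) (suc x , there x∈p) with extremum (f ∘ suc) p (x , x∈p)
  ... | y , y∈p , best = suc y , there y∈p , λ { (there z∈p) → best z∈p }
  extremum f (inside ∷ p) _ with nonempty? p
  ... | no p-empty = zero , here , λ { here → ≼-refl ; (there z∈p) → contradiction (_ , z∈p) p-empty }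
  ... | yes p-ne with extremum (f ∘ suc) p p-ne
  ...   | y , y∈p , best with ≼-total (f zero) (f (suc y))
  ...     | inj₁ f₀≼ = zero , here , λ { here → ≼-refl ; (there z∈p) → ≼-trans f₀≼ (best z∈p) }
  ...     | inj₂ ≼f₀ = suc y , there y∈p , λ { here → ≼f₀ ; (there z∈p) → best z∈p }

enumerate : ∀ {n} (p : Subset n) → ∃ λ (g : Fin ∣ p ∣ → Fin n) → Injective _≡_ _≡_ g × (∀ i → g i ∈ p)
enumerate [] = (λ ()) , (λ {}) , (λ ())
enumerate (outside ∷ p) with enumerate p
... | g , g-inj , g∈p = suc ∘ g , g-inj ∘ suc-injectiveᶠ , there ∘ g∈p
enumerate (inside ∷ p) with enumerate p
... | g , g-inj , g∈p = g′ , g′-inj , g′∈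
  where
  g′ : Fin (suc ∣ p ∣) → Fin _
  g′ zero = zero
  g′ (suc i) = suc (g i)
  g′-inj : Injective _≡_ _≡_ g′
  g′-inj {zero} {zero} _ = refl
  g′-inj {suc i} {suc j} eq = cong suc (g-inj (suc-injectiveᶠ eq))
  g′∈ : ∀ i → g′ i ∈ inside ∷ p
  g′∈ zero = here
  g′∈ (suc i) = there (g∈p i)

meets⁺ : ∀ {n} {p q : Subset n} {x} → x ∈ p → x ∈ q → T (meets p q)
meets⁺ here here = _
meets⁺ {p = inside ∷ _} {inside ∷ _} (there _) (there _) = _
meets⁺ {p = inside ∷ _} {outside ∷ _} (there x∈p) (there x∈q) = meets⁺ x∈p x∈q
meets⁺ {p = outside ∷ _} {_ ∷ _} (there x∈p) (there x∈q) = meets⁺ x∈p x∈q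

meets⁻ : ∀ {n} (p q : Subset n) → T (meets p q) → ∃ λ x → x ∈ p × x ∈ q
meets⁻ [] [] ()
meets⁻ (inside ∷ p) (inside ∷ q) _ = zero , here , here
meets⁻ (inside ∷ p) (outside ∷ q) m with meets⁻ p q m
... | x , x∈p , x∈q = suc x , there x∈p , there x∈q
meets⁻ (outside ∷ p) (_ ∷ q) m with meets⁻ p q m
... | x , x∈p , x∈q = suc x , there x∈p , there x∈q

Crosses : ∀ {n} → Subset n → Subset n → Set
Crosses e A = (∃ λ v → v ∈ e × v ∈ A) × (∃ λ w → w ∈ e × w ∉ A)

crosses? : ∀ {n} (e A : Subset n) → Dec (Crosses e A)
crosses? e A = map′ split join (T? (crosses e A))
  where
  split : T (crosses e A) → Crosses e A
  split c with Equivalence.to T-∧ c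
  ... | m₁ , m₂ with meets⁻ e A m₁ | meets⁻ e (∁ A) m₂
  ... | v , v∈e , v∈A | w , w∈e , w∈∁A = (v , v∈e , v∈A) , (w , w∈e , x∈∁p⇒x∉p w∈∁A)
  join : Crosses e A → T (crosses e A)
  join ((v , v∈e , v∈A) , (w , w∈e , w∉A)) =
    Equivalence.from T-∧ (meets⁺ v∈e v∈A , meets⁺ w∈e (x∉p⇒x∈∁p w∉A))

edge : (G : Hypergraph) → Fin (m G) → Subset (n G)
edge G = lookup (edges G)

d≡∑ : ∀ G A → d G A ≡ ∑[ i < m G ] ⟦ crosses? (edge G i) A ⟧
d≡∑ G A = countCrossing≡∑ (edges G)
  where
  countCrossing≡∑ : ∀ {k} (es : Vec (Subset (n G)) k) →
                    countCrossing es A ≡ ∑[ i < k ] ⟦ crosses? (lookup es i) A ⟧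
  countCrossing≡∑ [] = refl
  countCrossing≡∑ (e ∷ es) = cong (ind (crosses e A) +_) (countCrossing≡∑ es)

-- The cut-set of a labelling

module LabelCut (G : Hypergraph) (ℓ : Fin (n G) → ℕ) where

  Splits : Subset (n G) → Set
  Splits e = ∃ λ v → v ∈ e × ∃ λ w → w ∈ e × ℓ v ≢ ℓ w

  splits? : ∀ e → Dec (Splits e)
  splits? e = any? λ v → v ∈? e ×-dec any? λ w → w ∈? e ×-dec ¬? (ℓ v ≟ ℓ w)

  splitEdges : Subset (m G)
  splitEdges = setOf (splits? ∘ edge G)

  cost : ℕ
  cost = ∑[ i < m G ] ⟦ splits? (edge G i) ⟧

  connected⇒sameLabel : ∀ {u v} → Connected G splitEdges u v → ℓ u ≡ ℓ v
  connected⇒sameLabel = Star.fold (λ u v → ℓ u ≡ ℓ v) (trans ∘ adjacent⇒sameLabel) refl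
    where
    adjacent⇒sameLabel : ∀ {u v} → Adjacent G splitEdges u v → ℓ u ≡ ℓ v
    adjacent⇒sameLabel {u} {v} (i , i∉ , u∈ , v∈) with ℓ u ≟ ℓ v
    ... | yes ℓu≡ℓv = ℓu≡ℓv
    ... | no ℓu≢ℓv = contradiction (∈-setOf⁺ (splits? ∘ edge G) (u , u∈ , v , v∈ , ℓu≢ℓv)) i∉

  min-cut≤cost : ∀ {k F} → IsMinKCutSet G k F →
                 (f : Fin k → Fin (n G)) → Injective _≡_ _≡_ (ℓ ∘ f) → ∣ F ∣ ≤ cost
  min-cut≤cost (_ , minimal) f ℓf-inj = ≤-trans (minimal splitEdges (f , separated))
                                                (≤-reflexive (∣setOf∣ (splits? ∘ edge G)))
    where
    separated : ∀ i j → i ≢ j → ¬ Connected G splitEdges (f i) (f j)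
    separated i j i≢j = i≢j ∘ ℓf-inj ∘ connected⇒sameLabel

-- Uncrossing a family of vertex sets

module Uncrossing (G : Hypergraph) {N : ℕ} (A : Fin N → Subset (n G))
                  (w₁ w₂ : Fin N → ℕ) (disjoint : ∀ l → w₁ l ≡ 0 ⊎ w₂ l ≡ 0) where

  private
    V : ℕ
    V = n G

  h : Fin V → ℕ
  h v = ∑[ l < N ] ⟦ v ∈? A l ⟧

  Level : ℕ → Subset V
  Level r = setOf (λ v → r ≤? h v)

  Private : Fin V → Fin N → Set
  Private v l = v ∈ A l × (∀ l′ → v ∈ A l′ → l′ ≡ l)

  private? : ∀ v l → Dec (Private v l)
  private? v l = v ∈? A l ×-dec all? (λ l′ → v ∈? A l′ →-dec l′ ≟ᶠ l)

  label : (Fin N → ℕ) → Fin V → ℕ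
  label w v = ∑[ l < N ] (⟦ private? v l ⟧ * w l)

  private⇒h≡1 : ∀ {v l} → Private v l → h v ≡ 1
  private⇒h≡1 {v} {l} (v∈A , unique) =
    trans (∑-single _ l λ l′ l′≢l → ⟦⟧-no (v ∈? A l′) (l′≢l ∘ unique l′)) (⟦⟧-yes (v ∈? A l) v∈A)

  h≤1⇒private : ∀ {v l} → h v ≤ 1 → v ∈ A l → Private v l
  h≤1⇒private {v} {l} h≤1 v∈A = v∈A , unique
    where
    unique : ∀ l′ → v ∈ A l′ → l′ ≡ l
    unique l′ v∈A′ with l′ ≟ᶠ l
    ... | yes l′≡l = l′≡l
    ... | no l′≢l = contradiction (≤-trans 2≤h[v] h≤1) λ { (s≤s ()) }
      where
      2≤h[v] : 2 ≤ h v
      2≤h[v] = subst₂ (λ a b → a + b ≤ h v) (⟦⟧-yes (v ∈? A l′) v∈A′) (⟦⟧-yes (v ∈? A l) v∈A)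
                      (two-terms≤∑ _ l′≢l)

  private-unique : ∀ {v l l′} → Private v l → Private v l′ → l′ ≡ l
  private-unique (_ , unique) (v∈A′ , _) = unique _ v∈A′

  label-private : ∀ w {v l} → Private v l → label w v ≡ w l
  label-private w {v} {l} pv = begin
    label w v               ≡⟨ ∑-single _ l others ⟩
    ⟦ private? v l ⟧ * w l  ≡⟨ cong (_* w l) (⟦⟧-yes (private? v l) pv) ⟩
    1 * w l                 ≡⟨ *-identityˡ (w l) ⟩
    w l                     ∎
    where
    open ≡-Reasoning
    others : ∀ l′ → l′ ≢ l → ⟦ private? v l′ ⟧ * w l′ ≡ 0
    others l′ l′≢l = cong (_* w l′) (⟦⟧-no (private? v l′) (l′≢l ∘ private-unique pv))

  label≢0⇒private : ∀ w {v} → label w v ≢ 0 → ∃ λ l → Private v l × w l ≢ 0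
  label≢0⇒private w {v} label≢0 with ∑≢0⇒∃ _ label≢0
  ... | l , term≢0 =
    l , ⟦⟧≢0⇒ (private? v l) (term≢0 ∘ cong (_* w l))
      , λ wl≡0 → term≢0 (trans (cong (⟦ private? v l ⟧ *_) wl≡0) (*-zeroʳ ⟦ private? v l ⟧))

  record SplitWitness (w : Fin N → ℕ) (e : Subset V) : Set where
    field
      owner : Fin N
      owner-weight≢0 : w owner ≢ 0
      vertex : Fin V
      vertex∈e : vertex ∈ e
      vertex-private : Private vertex owner
      other : Fin V
      other∈e : other ∈ e
      other-label≢ : label w other ≢ w owner

  nonzero-endpoint⇒witness : ∀ w {e v x} → v ∈ e → x ∈ e → label w x ≢ label w v → label w v ≢ 0 →
                             SplitWitness w e
  nonzero-endpoint⇒witness w {v = v} {x} v∈e x∈e ℓx≢ℓv ℓv≢0 with label≢0⇒private w ℓv≢0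
  ... | l , pv , wl≢0 = record
    { owner = l ; owner-weight≢0 = wl≢0 ; vertex = v ; vertex∈e = v∈e ; vertex-private = pv
    ; other = x ; other∈e = x∈e ; other-label≢ = λ ℓx≡wl → ℓx≢ℓv (trans ℓx≡wl (sym (label-private w pv))) }

  splits⇒witness : ∀ w {e} → LabelCut.Splits G (label w) e → SplitWitness w e
  splits⇒witness w (v , v∈e , x , x∈e , ℓv≢ℓx) with label w v ≟ 0
  ... | no ℓv≢0 = nonzero-endpoint⇒witness w v∈e x∈e (ℓv≢ℓx ∘ sym) ℓv≢0
  ... | yes ℓv≡0 = nonzero-endpoint⇒witness w x∈e v∈e ℓv≢ℓx (λ ℓx≡0 → ℓv≢ℓx (trans ℓv≡0 (sym ℓx≡0)))

  private⇒∉ : ∀ {v l l′} → Private v l → l′ ≢ l → v ∉ A l′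
  private⇒∉ (_ , unique) l′≢l v∈A′ = l′≢l (unique _ v∈A′)

  witness-owner-crossed : ∀ {w e} (s : SplitWitness w e) → (∀ {y} → y ∈ e → h y ≤ 1) →
                          Crosses e (A (SplitWitness.owner s))
  witness-owner-crossed {w} s ≤1 = (vertex , vertex∈e , proj₁ vertex-private) , (other , other∈e , other∉A)
    where
    open SplitWitness s
    other∉A : other ∉ A owner
    other∉A other∈A = other-label≢ (label-private w (h≤1⇒private (≤1 other∈e) other∈A))

  witnesses-owners-differ : ∀ {e} (s₁ : SplitWitness w₁ e) (s₂ : SplitWitness w₂ e) →
                            SplitWitness.owner s₁ ≢ SplitWitness.owner s₂
  witnesses-owners-differ s₁ s₂ refl with disjoint (SplitWitness.owner s₁)
  ... | inj₁ w₁≡0 = SplitWitness.owner-weight≢0 s₁ w₁≡0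
  ... | inj₂ w₂≡0 = SplitWitness.owner-weight≢0 s₂ w₂≡0

  -- one of the two private vertices lies outside A l
  witnesses⇒crossed : ∀ {e} (s₁ : SplitWitness w₁ e) (s₂ : SplitWitness w₂ e) →
                      ∀ {l x} → x ∈ e → x ∈ A l → Crosses e (A l)
  witnesses⇒crossed s₁ s₂ {l} {x} x∈e x∈A with l ≟ᶠ SplitWitness.owner s₁
  ... | yes refl = (x , x∈e , x∈A) , (vertex s₂ , vertex∈e s₂ ,
                     private⇒∉ (vertex-private s₂) (witnesses-owners-differ s₁ s₂))
    where open SplitWitness
  ... | no l≢owner = (x , x∈e , x∈A) , (vertex s₁ , vertex∈e s₁ , private⇒∉ (vertex-private s₁) l≢owner)
    where open SplitWitness

  crossings : Subset V → ℕ
  crossings e = ∑[ l < N ] ⟦ crosses? e (A l) ⟧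

  level : Fin (N ∸ 2) → Subset V
  level i = Level (toℕ i + 3)

  levelCrossings : Subset V → ℕ
  levelCrossings e = ∑[ i < N ∸ 2 ] ⟦ crosses? e (level i) ⟧

  module Extremes {e : Subset V} {p q : Fin V} (p∈e : p ∈ e) (q∈e : q ∈ e)
                  (p-min : ∀ {y} → y ∈ e → h p ≤ h y) (q-max : ∀ {y} → y ∈ e → h y ≤ h q) where

    spread≤crossings : h q ∸ h p ≤ crossings e
    spread≤crossings = m≤n+o⇒m∸n≤o (h q) (h p) (begin
      h q                                              ≤⟨ ∑-mono-≤ pointwise ⟩
      ∑[ l < N ] (⟦ p ∈? A l ⟧ + ⟦ crosses? e (A l) ⟧)  ≡⟨ ∑-distrib-+ (λ l → ⟦ p ∈? A l ⟧) _ ⟩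
      h p + crossings e                                ∎)
      where
      open ≤-Reasoning
      pointwise : ∀ l → ⟦ q ∈? A l ⟧ ≤ ⟦ p ∈? A l ⟧ + ⟦ crosses? e (A l) ⟧
      pointwise l with p ∈? A l
      ... | yes _ = ≤-trans (⟦⟧≤1 (q ∈? A l)) (m≤m+n 1 _)
      ... | no p∉A = ⟦⟧-mono (q ∈? A l) (crosses? e (A l)) λ q∈A → (q , q∈e , q∈A) , (p , p∈e , p∉A)

    levelCrossings≤ : levelCrossings e ≤ h q ∸ (h p ⊔ 2)
    levelCrossings≤ =
      ≤-trans (∑-mono-≤ {N ∸ 2} λ i → ⟦⟧-mono (crosses? e (level i)) (inRange? (h p) (h q) (toℕ i + 3)) between)
              (∑-inRange≤ (N ∸ 2) (h p) (h q) 2)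
      where
      between : ∀ {r} → Crosses e (Level r) → InRange (h p) (h q) r
      between {r} ((v , v∈e , v∈L) , (w , w∈e , w∉L)) =
        ≤-<-trans (p-min w∈e) (≰⇒> (w∉L ∘ ∈-setOf⁺ (λ v → r ≤? h v))) ,
        ≤-trans (∈-setOf⁻ (λ v → r ≤? h v) v∈L) (q-max v∈e)

    no-split : levelCrossings e ≤ crossings e
    no-split = ≤-trans levelCrossings≤ (≤-trans (∸-monoʳ-≤ (h q) (m≤m⊔n (h p) 2)) spread≤crossings)

    module _ {w} (s : SplitWitness w e) where
      open SplitWitness s

      h[p]≤1 : h p ≤ 1
      h[p]≤1 = subst (h p ≤_) (private⇒h≡1 vertex-private) (p-min vertex∈e)

      levelCrossings≤h[q]∸2 : levelCrossings e ≤ h q ∸ 2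
      levelCrossings≤h[q]∸2 =
        subst (λ c → levelCrossings e ≤ h q ∸ c) (m≤n⇒m⊔n≡n (≤-trans h[p]≤1 (n≤1+n 1))) levelCrossings≤

      one-split : 1 + levelCrossings e ≤ crossings e
      one-split = ≤-trans (+-monoʳ-≤ 1 levelCrossings≤h[q]∸2)
                          (1+[x∸2]≤ (h q) one-crossing (≤-trans (∸-monoʳ-≤ (h q) h[p]≤1) spread≤crossings))
        where
        one-crossing : 1 ≤ crossings e
        one-crossing with h q ≤? 1
        ... | yes h[q]≤1 = subst (_≤ crossings e)
                (⟦⟧-yes (crosses? e (A owner)) (witness-owner-crossed s λ y∈e → ≤-trans (q-max y∈e) h[q]≤1))
                (term≤∑ _ owner)
        ... | no h[q]≰1 = ≤-trans (m<n⇒0<n∸m (≤-<-trans h[p]≤1 (≰⇒> h[q]≰1))) spread≤crossings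

    two-splits : SplitWitness w₁ e → SplitWitness w₂ e → 2 + levelCrossings e ≤ crossings e
    two-splits s₁ s₂ = ≤-trans (+-monoʳ-≤ 2 (levelCrossings≤h[q]∸2 s₁))
                               (2+[x∸2]≤ (h q) two-crossings h[q]≤crossings)
      where
      open SplitWitness
      crossed : ∀ {l x} → x ∈ e → x ∈ A l → ⟦ crosses? e (A l) ⟧ ≡ 1
      crossed x∈e x∈A = ⟦⟧-yes (crosses? e _) (witnesses⇒crossed s₁ s₂ x∈e x∈A)
      two-crossings : 2 ≤ crossings e
      two-crossings = subst₂ (λ a b → a + b ≤ crossings e)
        (crossed (vertex∈e s₁) (proj₁ (vertex-private s₁))) (crossed (vertex∈e s₂) (proj₁ (vertex-private s₂)))
        (two-terms≤∑ _ (witnesses-owners-differ s₁ s₂))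
      h[q]≤crossings : h q ≤ crossings e
      h[q]≤crossings = ∑-mono-≤ λ l → ⟦⟧-mono (q ∈? A l) (crosses? e (A l)) (witnesses⇒crossed s₁ s₂ q∈e)

  open LabelCut G (label w₁) public using () renaming (Splits to Splits₁; splits? to splits₁?; cost to cost₁)
  open LabelCut G (label w₂) public using () renaming (Splits to Splits₂; splits? to splits₂?; cost to cost₂)

  per-edge : ∀ e → ⟦ splits₁? e ⟧ + ⟦ splits₂? e ⟧ + levelCrossings e ≤ crossings e
  per-edge e with nonempty? e
  ... | no e-empty = ≤-trans (≤-reflexive nothing-crosses) z≤n
    where
    nothing-crosses : ⟦ splits₁? e ⟧ + ⟦ splits₂? e ⟧ + levelCrossings e ≡ 0
    nothing-crosses = cong₂ _+_
      (cong₂ _+_ (⟦⟧-no (splits₁? e) λ (v , v∈e , _) → e-empty (v , v∈e))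
                 (⟦⟧-no (splits₂? e) λ (v , v∈e , _) → e-empty (v , v∈e)))
      (∑-zero {N ∸ 2} λ i → ⟦⟧-no (crosses? e (level i)) λ ((v , v∈e , _) , _) → e-empty (v , v∈e))
  ... | yes e-ne with extremum ≤-trans ≤-total h e e-ne | extremum (flip ≤-trans) (flip ≤-total) h e e-ne
  ...   | p , p∈e , p-min | q , q∈e , q-max = by-splits (splits₁? e) (splits₂? e)
    where
    open Extremes p∈e q∈e p-min q-max
    by-splits : (s₁? : Dec (Splits₁ e)) (s₂? : Dec (Splits₂ e)) →
                ⟦ s₁? ⟧ + ⟦ s₂? ⟧ + levelCrossings e ≤ crossings e
    by-splits (no _) (no _) = no-split
    by-splits (yes s₁) (no _) = one-split (splits⇒witness w₁ s₁)
    by-splits (no _) (yes s₂) = one-split (splits⇒witness w₂ s₂)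
    by-splits (yes s₁) (yes s₂) = two-splits (splits⇒witness w₁ s₁) (splits⇒witness w₂ s₂)

  uncrossing : cost₁ + cost₂ + ∑[ i < N ∸ 2 ] d G (level i) ≤ ∑[ l < N ] d G (A l)
  uncrossing = begin
    cost₁ + cost₂ + ∑[ i < N ∸ 2 ] d G (level i)
      ≡⟨ cong (cost₁ + cost₂ +_) (trans (sum-cong-≗ {N ∸ 2} (d≡∑ G ∘ level))
                                        (∑-comm {N ∸ 2} λ i j → ⟦ crosses? (edge G j) (level i) ⟧)) ⟩
    cost₁ + cost₂ + ∑[ j < m G ] levelCrossings (edge G j)
      ≡⟨ cong (_+ ∑[ j < m G ] levelCrossings (edge G j))
              (∑-distrib-+ (⟦_⟧ ∘ splits₁? ∘ edge G) (⟦_⟧ ∘ splits₂? ∘ edge G)) ⟨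
    ∑[ j < m G ] (⟦ splits₁? (edge G j) ⟧ + ⟦ splits₂? (edge G j) ⟧) + ∑[ j < m G ] levelCrossings (edge G j)
      ≡⟨ ∑-distrib-+ (λ j → ⟦ splits₁? (edge G j) ⟧ + ⟦ splits₂? (edge G j) ⟧)
                     (levelCrossings ∘ edge G) ⟨
    ∑[ j < m G ] (⟦ splits₁? (edge G j) ⟧ + ⟦ splits₂? (edge G j) ⟧ + levelCrossings (edge G j))
      ≤⟨ ∑-mono-≤ (per-edge ∘ edge G) ⟩
    ∑[ j < m G ] crossings (edge G j)
      ≡⟨ trans (sum-cong-≗ {N} (d≡∑ G ∘ A)) (∑-comm {N} λ l j → ⟦ crosses? (edge G j) (A l) ⟧) ⟨
    ∑[ l < N ] d G (A l) ∎
    where open ≤-Reasoning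

-- Pinning sets

weightˡ weightʳ : ∀ K → Fin (K + K) → ℕ
weightˡ K = Sum.[ suc ∘ toℕ , const 0 ]′ ∘ splitAt K
weightʳ K = Sum.[ const 0 , suc ∘ toℕ ]′ ∘ splitAt K

weights-disjoint : ∀ K l → weightˡ K l ≡ 0 ⊎ weightʳ K l ≡ 0
weights-disjoint K l with splitAt K l
... | inj₁ _ = inj₂ refl
... | inj₂ _ = inj₁ refl

≗toℕ⇒injective : ∀ {k} {φ : Fin k → ℕ} → (∀ i → φ i ≡ toℕ i) → Injective _≡_ _≡_ φ
≗toℕ⇒injective φ≗toℕ {i} {j} φi≡φj = toℕ-injective (trans (sym (φ≗toℕ i)) (trans φi≡φj (φ≗toℕ j)))

module Pinning (G : Hypergraph) (U : Subset (n G)) (t : Fin (n G)) where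

  V : ℕ
  V = n G

  Rival : Subset V → Set
  Rival Z = Nonempty Z × Z ⊆ ∁ U × t ∉ Z × d G (U ∪ Z) ≤ d G U

  rival? : ∀ Z → Dec (Rival Z)
  rival? Z = nonempty? Z ×-dec Z ⊆? ∁ U ×-dec ¬? (t ∈? Z) ×-dec d G (U ∪ Z) ≤? d G U

  Pins : Subset V → Set
  Pins T = ∀ Z → Rival Z → Nonempty (Z ∩ T)

  pins-or-escapes : ∀ T → Pins T ⊎ ∃ λ Z → Rival Z × Empty (Z ∩ T)
  pins-or-escapes T with anySubset? (λ Z → rival? Z ×-dec ¬? (nonempty? (Z ∩ T)))
  ... | yes escape = inj₂ escape
  ... | no no-escape =
    inj₁ λ Z rival → decidable-stable (nonempty? (Z ∩ T)) λ empty → no-escape (Z , rival , empty)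

  pins? : ∀ T → Dec (Pins T)
  pins? T with pins-or-escapes T
  ... | inj₁ pins = yes pins
  ... | inj₂ (Z , rival , empty) = no λ pins → empty (pins Z rival)

  Irreducible : Subset V → Set
  Irreducible T = ∀ {x} → x ∈ T → ¬ Pins (T - x)

  irreducible-pinning-⊆ : ∀ T → Pins T → ∃ λ T′ → T′ ⊆ T × Pins T′ × Irreducible T′
  irreducible-pinning-⊆ T = go T (<-wellFounded ∣ T ∣)
    where
    go : ∀ T → Acc _<_ ∣ T ∣ → Pins T → ∃ λ T′ → T′ ⊆ T × Pins T′ × Irreducible T′
    go T (acc smaller) pins-T with any? (λ x → x ∈? T ×-dec pins? (T - x))
    ... | no irreducible = T , id , pins-T , λ x∈T pins-T-x → irreducible (_ , x∈T , pins-T-x)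
    ... | yes (x , x∈T , pins-T-x) with go (T - x) (smaller (x∈p⇒∣p-x∣<∣p∣ x∈T)) pins-T-x
    ...   | T′ , T′⊆T-x , pins-T′ , irreducible = T′ , p─q⊆p T ⁅ x ⁆ ∘ T′⊆T-x , pins-T′ , irreducible

  ∁U-t-pins : Pins (∁ U - t)
  ∁U-t-pins Z ((x , x∈Z) , Z⊆∁U , t∉Z , _) =
    x , x∈p∩q⁺ (x∈Z , x∈p∧x≢y⇒x∈p-y (Z⊆∁U x∈Z) λ { refl → t∉Z x∈Z })

  module _ {T} (pins-T : Pins T) {Y} (Y⊆∁U : Y ⊆ ∁ U) (t∉Y : t ∉ Y) (Y∩T-empty : Empty (Y ∩ T)) where

    pins⇒d<d : Nonempty Y → d G U < d G (U ∪ Y)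
    pins⇒d<d Y-ne = ≰⇒> λ d≤d → Y∩T-empty (pins-T Y (Y-ne , Y⊆∁U , t∉Y , d≤d))

    pins⇒d≤d : d G U ≤ d G (U ∪ Y)
    pins⇒d≤d with nonempty? Y
    ... | yes Y-ne = <⇒≤ (pins⇒d<d Y-ne)
    ... | no Y-empty =
      ≤-reflexive (cong (d G) (trans (sym (∪-identityʳ U)) (cong (U ∪_) (sym (Empty-unique Y-empty)))))

  pins⇒unique-min-cut : ∀ {T} → Pins T → T ⊆ ∁ U → t ∉ U → IsUniqueMinTerminalCut G U (T ∪ ⁅ t ⁆) U
  pins⇒unique-min-cut {T} pins-T T⊆∁U t∉U =
    (id , U⊆∁T∪t) , (λ B cut → Sum.[ ≤-reflexive ∘ cong (d G) ∘ sym , <⇒≤ ]′ (cut-or-larger B cut)) ,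
    λ B cut d≡d → Sum.[ id , (λ d< → contradiction (sym d≡d) (<⇒≢ d<)) ]′ (cut-or-larger B cut)
    where
    T∪t = T ∪ ⁅ t ⁆
    U⊆∁T∪t : U ⊆ ∁ T∪t
    U⊆∁T∪t {x} x∈U = x∉p⇒x∈∁p (Sum.[ (λ x∈T → x∈∁p⇒x∉p (T⊆∁U x∈T) x∈U)
                                   , (λ x∈⁅t⁆ → t∉U (subst (_∈ U) (x∈⁅y⁆⇒x≡y t x∈⁅t⁆) x∈U)) ]′
                               ∘ x∈p∪q⁻ T ⁅ t ⁆)
    cut-or-larger : ∀ B → IsTerminalCut G U T∪t B → B ≡ U ⊎ d G U < d G B
    cut-or-larger B (U⊆B , B⊆∁T∪t) with nonempty? (B ─ U)
    ... | yes B─U-ne = inj₂ (subst (λ A → d G U < d G A) (p⊆q⇒p∪[q─p]≡q U⊆B)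
                                   (pins⇒d<d pins-T B─U⊆∁U t∉B─U B─U∩T-empty B─U-ne))
      where
      B-avoids : ∀ {x} → x ∈ B ─ U → x ∉ T∪t
      B-avoids = x∈∁p⇒x∉p ∘ B⊆∁T∪t ∘ p─q⊆p B U
      B─U⊆∁U : B ─ U ⊆ ∁ U
      B─U⊆∁U = x∉p⇒x∈∁p ∘ x∈p─q⇒x∉q
      t∉B─U : t ∉ B ─ U
      t∉B─U t∈B─U = B-avoids t∈B─U (x∈p∪q⁺ (inj₂ (x∈⁅x⁆ t)))
      B─U∩T-empty : Empty ((B ─ U) ∩ T)
      B─U∩T-empty (x , x∈B─U∩T) with x∈p∩q⁻ (B ─ U) T x∈B─U∩T
      ... | x∈B─U , x∈T = B-avoids x∈B─U (x∈p∪q⁺ (inj₁ x∈T))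
    ... | no B─U-empty = inj₁ (⊆-antisym B⊆U U⊆B)
      where
      B⊆U : B ⊆ U
      B⊆U {x} x∈B with x ∈? U
      ... | yes x∈U = x∈U
      ... | no x∉U = contradiction (x , x∈p∧x∉q⇒x∈p─q x∈B x∉U) B─U-empty

  module RivalFamily {T} (pins-T : Pins T) (irreducible : Irreducible T) (T⊆∁U : T ⊆ ∁ U) (t∉U : t ∉ U)
                 {N} (g : Fin N → Fin V) (g-inj : Injective _≡_ _≡_ g) (g∈T : ∀ l → g l ∈ T)
                 (w₁ w₂ : Fin N → ℕ) (disjoint : ∀ l → w₁ l ≡ 0 ⊎ w₂ l ≡ 0) where

    escape : ∀ l → ∃ λ Z → Rival Z × Empty (Z ∩ (T - g l))
    escape l with pins-or-escapes (T - g l)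
    ... | inj₁ pins = contradiction pins (irreducible (g∈T l))
    ... | inj₂ Z-escapes = Z-escapes

    Z : Fin N → Subset V
    Z = proj₁ ∘ escape

    Z-rival : ∀ l → Rival (Z l)
    Z-rival = proj₁ ∘ proj₂ ∘ escape

    t∉Z : ∀ l → t ∉ Z l
    t∉Z l = proj₁ (proj₂ (proj₂ (Z-rival l)))

    Z∩T≡g : ∀ l {x} → x ∈ Z l → x ∈ T → x ≡ g l
    Z∩T≡g l {x} x∈Z x∈T with x ≟ᶠ g l
    ... | yes x≡g = x≡g
    ... | no x≢g = contradiction (x , x∈p∩q⁺ (x∈Z , x∈p∧x≢y⇒x∈p-y x∈T x≢g)) (proj₂ (proj₂ (escape l)))

    g∈Z : ∀ l → g l ∈ Z l
    g∈Z l with pins-T (Z l) (Z-rival l)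
    ... | x , x∈Z∩T with x∈p∩q⁻ (Z l) T x∈Z∩T
    ...   | x∈Z , x∈T = subst (_∈ Z l) (Z∩T≡g l x∈Z x∈T) x∈Z

    A : Fin N → Subset V
    A l = U ∪ Z l

    open Uncrossing G A w₁ w₂ disjoint public

    ∈A⇒∈Z : ∀ {l x} → x ∉ U → x ∈ A l → x ∈ Z l
    ∈A⇒∈Z {l} x∉U x∈A = Sum.[ flip contradiction x∉U , id ]′ (x∈p∪q⁻ U (Z l) x∈A)

    d-A≤d-U : ∀ l → d G (A l) ≤ d G U
    d-A≤d-U l = proj₂ (proj₂ (proj₂ (Z-rival l)))

    h-U : ∀ {u} → u ∈ U → h u ≡ N
    h-U {u} u∈U = begin
      h u             ≡⟨ sum-cong-≗ {N} (λ l → ⟦⟧-yes (u ∈? A l) (x∈p∪q⁺ (inj₁ u∈U))) ⟩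
      ∑[ l < N ] 1    ≡⟨ ∑-const N 1 ⟩
      N * 1           ≡⟨ *-identityʳ N ⟩
      N               ∎
      where open ≡-Reasoning

    h-t : h t ≡ 0
    h-t = ∑-zero λ l → ⟦⟧-no (t ∈? A l) λ t∈A → t∉Z l (∈A⇒∈Z t∉U t∈A)

    g-private : ∀ l → Private (g l) l
    g-private l = x∈p∪q⁺ (inj₂ (g∈Z l)) , λ l′ g∈A → g-inj (sym (Z∩T≡g l′ (∈A⇒∈Z g∉U g∈A) (g∈T l)))
      where
      g∉U : g l ∉ U
      g∉U = x∈∁p⇒x∉p (T⊆∁U (g∈T l))

    h≤1-on-T : ∀ {v} → v ∈ T → h v ≤ 1
    h≤1-on-T {v} v∈T with any? (λ l → v ∈? A l)
    ... | yes (l , v∈A) = ≤-reflexive (private⇒h≡1 (subst (λ x → Private x l) (sym v≡g) (g-private l)))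
      where
      v≡g : v ≡ g l
      v≡g = Z∩T≡g l (∈A⇒∈Z (x∈∁p⇒x∉p (T⊆∁U v∈T)) v∈A) v∈T
    ... | no in-no-A = ≤-trans (≤-reflexive (∑-zero λ l → ⟦⟧-no (v ∈? A l) λ v∈A → in-no-A (l , v∈A))) z≤n

    d-U≤d-Level : ∀ {r} → 2 ≤ r → r ≤ N → d G U ≤ d G (Level r)
    d-U≤d-Level {r} 2≤r r≤N = subst (λ L → d G U ≤ d G L) (p⊆q⇒p∪[q─p]≡q U⊆L)
                                    (pins⇒d≤d pins-T (x∉p⇒x∈∁p ∘ x∈p─q⇒x∉q) t∉L─U L─U∩T-empty)
      where
      L = Level r
      U⊆L : U ⊆ L
      U⊆L u∈U = ∈-setOf⁺ (λ v → r ≤? h v) (subst (r ≤_) (sym (h-U u∈U)) r≤N)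
      high : ∀ {x} → x ∈ L ─ U → r ≤ h x
      high = ∈-setOf⁻ (λ v → r ≤? h v) ∘ p─q⊆p L U
      t∉L─U : t ∉ L ─ U
      t∉L─U t∈ = <⇒≱ (≤-trans (s≤s z≤n) 2≤r) (subst (r ≤_) h-t (high t∈))
      L─U∩T-empty : Empty ((L ─ U) ∩ T)
      L─U∩T-empty (x , x∈L─U∩T) with x∈p∩q⁻ (L ─ U) T x∈L─U∩T
      ... | x∈L─U , x∈T = <⇒≱ 2≤r (≤-trans (high x∈L─U) (h≤1-on-T x∈T))

    label-U : ∀ w {u} → 2 ≤ N → u ∈ U → label w u ≡ 0
    label-U w {u} 2≤N u∈U = ∑-zero λ l → cong (_* w l) (⟦⟧-no (private? u l) λ pu →
      <⇒≢ 2≤N (trans (sym (private⇒h≡1 pu)) (h-U u∈U)))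

    label-g : ∀ w l → label w (g l) ≡ w l
    label-g w l = label-private w (g-private l)

    costs≤ : 2 ≤ N → cost₁ + cost₂ ≤ 2 * d G U
    costs≤ 2≤N = +-cancelʳ-≤ (M * δ) (cost₁ + cost₂) (2 * δ) (begin
      cost₁ + cost₂ + M * δ                              ≤⟨ +-monoʳ-≤ (cost₁ + cost₂) levels≥ ⟩
      cost₁ + cost₂ + ∑[ i < M ] d G (level i)            ≤⟨ uncrossing ⟩
      ∑[ l < N ] d G (A l)                               ≤⟨ ∑-mono-≤ d-A≤d-U ⟩
      ∑[ l < N ] δ                                       ≡⟨ ∑-const N δ ⟩
      N * δ                                              ≡⟨ cong (_* δ) (m+[n∸m]≡n 2≤N) ⟨
      (2 + M) * δ                                        ≡⟨ *-distribʳ-+ δ 2 M ⟩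
      2 * δ + M * δ                                      ∎)
      where
      open ≤-Reasoning
      δ = d G U
      M = N ∸ 2
      level-in-range : ∀ (i : Fin M) → toℕ i + 3 ≤ N
      level-in-range i = subst (toℕ i + 3 ≤_) (m+[n∸m]≡n 2≤N)
        (subst (_≤ 2 + M) (+-comm 3 (toℕ i)) (+-monoʳ-≤ 2 (toℕ<n i)))
      levels≥ : M * δ ≤ ∑[ i < M ] d G (level i)
      levels≥ = subst (_≤ ∑[ i < M ] d G (level i)) (∑-const M δ)
        (∑-mono-≤ {M} λ i → d-U≤d-Level (≤-trans (n≤1+n 2) (m≤n+m 3 (toℕ i))) (level-in-range i))

  irreducible-pinning-size : ∀ {k F T} → 2 ≤ k → IsMinKCutSet G k F → d G U < ∣ F ∣ → Nonempty U → t ∉ U →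
                             Pins T → Irreducible T → T ⊆ ∁ U → ∣ T ∣ ≤ 2 * k ∸ 3
  irreducible-pinning-size {suc (suc K)} {F} {T} (s≤s (s≤s z≤n)) min-cut d<OPT (u , u∈U) t∉U
                           pins-T irreducible T⊆∁U =
    subst (∣ T ∣ ≤_) (sym (2*[2+K]∸3≡K+[1+K] K)) (s≤s⁻¹ (≰⇒> too-large))
    where
    H = suc K
    too-large : ¬ (H + H ≤ ∣ T ∣)
    too-large crowded = <⇒≱ (+-mono-< (<-≤-trans d<OPT (OPT≤cost weightˡ fˡ labelˡ))
                                      (<-≤-trans d<OPT (OPT≤cost weightʳ fʳ labelʳ)))
                            (subst (cost₁ + cost₂ ≤_) (cong (d G U +_) (+-identityʳ (d G U))) (costs≤ 2≤N))
      where
      enumeration = enumerate T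
      g : Fin (H + H) → Fin V
      g l = proj₁ enumeration (inject≤ l crowded)
      g-inj : Injective _≡_ _≡_ g
      g-inj = inject≤-injective crowded crowded _ _ ∘ proj₁ (proj₂ enumeration)
      open RivalFamily pins-T irreducible T⊆∁U t∉U g g-inj (λ l → proj₂ (proj₂ enumeration) _)
                   (weightˡ H) (weightʳ H) (weights-disjoint H)
      2≤N : 2 ≤ H + H
      2≤N = s≤s (≤-trans (s≤s z≤n) (m≤n+m H K))
      OPT≤cost : ∀ w (f : Fin (suc H) → Fin V) → (∀ i → label (w H) (f i) ≡ toℕ i) →
                 ∣ F ∣ ≤ LabelCut.cost G (label (w H))
      OPT≤cost w f label≗toℕ = LabelCut.min-cut≤cost G (label (w H)) min-cut f (≗toℕ⇒injective label≗toℕ)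
      fˡ fʳ : Fin (suc H) → Fin V
      fˡ zero = u
      fˡ (suc i) = g (i ↑ˡ H)
      fʳ zero = u
      fʳ (suc i) = g (H ↑ʳ i)
      labelˡ : ∀ i → label (weightˡ H) (fˡ i) ≡ toℕ i
      labelˡ zero = label-U (weightˡ H) 2≤N u∈U
      labelˡ (suc i) = trans (label-g (weightˡ H) (i ↑ˡ H)) (cong Sum.[ suc ∘ toℕ , const 0 ]′ (splitAt-↑ˡ H i H))
      labelʳ : ∀ i → label (weightʳ H) (fʳ i) ≡ toℕ i
      labelʳ zero = label-U (weightʳ H) 2≤N u∈U
      labelʳ (suc i) = trans (label-g (weightʳ H) (H ↑ʳ i)) (cong Sum.[ const 0 , suc ∘ toℕ ]′ (splitAt-↑ʳ H H i))

corollary3p4 : (G : Hypergraph) (k : ℕ) → 2 ≤ k →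
    (F : Subset (m G)) → IsMinKCutSet G k F →
    (U : Subset (n G)) → Nonempty U → Nonempty (∁ U) →
    d G U < ∣ F ∣ →
    ∀ t → t ∈ ∁ U →
    ∃ λ (T : Subset (n G)) → (T ⊆ ∁ U) × (t ∉ T) × (∣ T ∣ ≤ 2 * k ∸ 3) ×
      IsUniqueMinTerminalCut G U (T ∪ ⁅ t ⁆) U
corollary3p4 G k 2≤k F min-cut U U-ne _ d<OPT t t∈∁U
  with Pinning.irreducible-pinning-⊆ G U t (∁ U - t) (Pinning.∁U-t-pins G U t)
... | T , T⊆∁U-t , pins-T , irreducible-T =
  T , T⊆∁U , t∉T , irreducible-pinning-size 2≤k min-cut d<OPT U-ne t∉U pins-T irreducible-T T⊆∁U ,
  pins⇒unique-min-cut pins-T T⊆∁U t∉U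
  where
  open Pinning G U t
  t∉U : t ∉ U
  t∉U = x∈∁p⇒x∉p t∈∁U
  T⊆∁U : T ⊆ ∁ U
  T⊆∁U = p─q⊆p (∁ U) ⁅ t ⁆ ∘ T⊆∁U-t
  t∉T : t ∉ T
  t∉T t∈T = x∈p─q⇒x∉q (T⊆∁U-t t∈T) (x∈⁅x⁆ t)
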